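{- Consider a nontrivial $m$-cycle of $C$ with local minima $n_1,\dots,n_m$ (indices extended periodically). For every $i\geq 1$ at least one of the following holds: $T(n_i)<k_i\cdot\frac34\cdot\frac{1}{X_0}$; or $T(n_i)+T(n_{i+1})<(k_i+k_{i+1})\cdot\frac34\cdot\frac{1}{X_0}$; or $T(n_i)+T(n_{i+1})+T(n_{i+2})<(k_i+k_{i+1}+k_{i+2})\cdot\frac34\cdot\frac{1}{X_0}$.
   Context: $C(n)=n/2$ for even $n$, $C(n)=(3n+1)/2$ for odd $n$ (on positive integers); $C^t$ is the $t$-fold iterate. A nontrivial cycle is a set $\{n,C(n),\dots,C^{p-1}(n)\}$ with $C^p(n)=n$, different from $\{1,2\}$. A local minimum of the cycle is an element smaller than its predecessor and successor along the cycle (equivalently, an odd element whose predecessor is even). An $m$-cycle is a nontrivial cycle with exactly $m$ local minima; list them as $n_1,\dots,n_m$ in order of appearance along the cycle (starting at any of them) and set $n_{i+m}:=n_i$. For each $i$, $k_i\geq1$ is such that $n_i,C(n_i),\dots,C^{k_i-1}(n_i)$ are odd and $C^{k_i}(n_i)$ is even (with $k_{i+m}=k_i$). Define $T(n_i):=\sum_{t=0}^{k_i-1}\frac{1}{C^t(n_i)}$. $X_0$ is a positive integer with $X_0>765$ such that for every positive integer $n\leq X_0$ the sequence $n,C(n),C^2(n),\dots$ eventually reaches $1$. -}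

module Defs where

open import Data.Nat using (ℕ; zero; suc; _+_; _*_; _∸_; _<_; _≤_; _%_)
open import Data.Nat.Divisibility using (_∣_)
open import Data.Integer using (+_)
open import Data.Rational using (ℚ; _/_; 0ℚ)
import Data.Rational as Q
open import Data.Product using (Σ; ∃; _×_)
open import Data.Sum using (_⊎_)
open import Relation.Nullary using (¬_)
open import Relation.Binary.PropositionalEquality using (_≡_)
open import Function.Bundles using (_⇔_)

Even : ℕ → Set
Even n = 2 ∣ n

Odd : ℕ → Set
Odd n = ¬ Even n

C : ℕ → ℕ
C n with n % 2
... | zero  = Data.Nat.⌊ n /2⌋
... | suc _ = Data.Nat.⌊ 3 * n + 1 /2⌋

iterC : ℕ → ℕ → ℕ
iterC zero    n = n
iterC (suc t) n = iterC t (C n)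

ReachesOne : ℕ → Set
ReachesOne n = ∃ λ t → iterC t n ≡ 1

IsX0 : ℕ → Set
IsX0 X₀ = 765 < X₀ × (∀ n → 1 ≤ n → n ≤ X₀ → ReachesOne n)

InCycle : ℕ → ℕ → ℕ → Set
InCycle n p x = ∃ λ t → t < p × iterC t n ≡ x

NontrivialCycle : ℕ → ℕ → Set
NontrivialCycle n p =
  1 ≤ n × 1 ≤ p × iterC p n ≡ n
  × (∀ q → 1 ≤ q → q < p → ¬ (iterC q n ≡ n))
  × ¬ (∀ x → InCycle n p x ⇔ (x ≡ 1 ⊎ x ≡ 2))

-- the element at position t of the cycle (generated by n, length p) is a local
-- minimum: smaller than its predecessor C^{t+p-1} n and its successor C^{t+1} n
LocalMinAt : ℕ → ℕ → ℕ → Set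
LocalMinAt n p t =
  iterC t n < iterC (p ∸ 1 + t) n × iterC t n < iterC (suc t) n

IsK : ℕ → ℕ → Set
IsK x k = 1 ≤ k × (∀ j → j < k → Odd (iterC j x)) × Even (iterC k x)

-- 1/d as a rational (with the harmless convention 1/0 := 0; only applied to
-- positive integers in the statement)
recip : ℕ → ℚ
recip zero    = 0ℚ
recip (suc d) = (+ 1) / suc d

T : ℕ → ℕ → ℚ
T x zero    = 0ℚ
T x (suc k) = T x k Q.+ recip (iterC k x)

bound : ℕ → ℕ → ℚ
bound X₀ k = ((+ k) / 1) Q.* ((+ 3) / 4) Q.* recip X₀

-- Every element of the cycle exceeds X₀: a smaller one would reach 1, and then the cycle would be {1, 2}.
-- Let x be a local minimum; it is odd. If x ≡ R (mod 2^a), write x = 2^a u + R: the first a steps of C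
-- are then affine in u, which fixes the parities of C^t x for t < a, hence the next local minima and
-- lower bounds for the odd runs starting at them. A visible term 1/C^t x is compared with 1/X₀ through
-- x or C^a x, which both exceed X₀; a later term of an odd run starting at y is at most 1/C y < (3/4)/X₀.
-- Eleven residue classes cover all odd x, and for each of them a computation shows that the first one,
-- two or three runs together stay below (3/4)/X₀ per term.
module Submission where

open import Defs
open import Data.Nat using (ℕ; zero; suc; _+_; _<_; _≤_)
open import Data.Rational using (ℚ) renaming (_+_ to _+ℚ_; _<_ to _<ℚ_)
open import Data.Product using (∃; _×_)
open import Data.Sum using (_⊎_)
open import Relation.Binary.PropositionalEquality using (_≡_)
open import Function.Bundles using (_⇔_)

open import Data.Nat as ℕ using (_*_; _∸_; _%_; ⌊_/2⌋; _⊔′_; _≡ᵇ_; pred; z≤n; s≤s; NonZero)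
import Data.Nat.Properties as ℕ
open import Data.Nat.DivMod using (m*n%n≡0; [m+kn]%n≡m%n; m*n/n≡m; m%n<n; m≡m%n+[m/n]*n)
open import Data.Nat.Divisibility using (_∣?_; m%n≡0⇒n∣m; n∣m⇒m%n≡0)
open import Data.Nat.Tactic.RingSolver using (solve-∀)
open import Data.Bool using (Bool; true; false; not; _∧_; _∨_; if_then_else_)
import Data.Bool as Bool
import Data.Bool.Properties as Bool
open import Data.Maybe using (Maybe; just; nothing)
open import Data.Integer as ℤ using (+_; +<+)
import Data.Integer.Properties as ℤ
open import Data.Rational as ℚ using (_/_; 0ℚ; toℚᵘ; fromℚᵘ)
import Data.Rational.Properties as ℚ
open import Data.Rational.Unnormalised as ℚᵘ using (ℚᵘ; mkℚᵘ; *<*; *≡*)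
import Data.Rational.Unnormalised.Properties as ℚᵘ
open import Data.Product using (_,_; proj₁; proj₂)
open import Data.Sum using (inj₁; inj₂)
open import Data.Empty using (⊥-elim)
open import Data.Unit using (tt)
open import Relation.Nullary using (¬_; yes; no; contradiction)
open import Relation.Binary.Definitions using (tri<; tri≈; tri>)
open import Relation.Binary.PropositionalEquality
  using (refl; sym; trans; cong; cong₂; subst; subst₂; module ≡-Reasoning)
open import Function.Bundles using (mk⇔; Equivalence)
open import Function.Base using (_∘_; _$_)
open import Algebra.Bundles using (CommutativeMonoid)
open import Algebra.Properties.CommutativeSemigroup (CommutativeMonoid.commutativeSemigroup ℚ.+-0-commutativeMonoid)
  using (interchange)

data Parity : ℕ → Set where
  even : ∀ m → Parity (m + m)
  odd  : ∀ m → Parity (suc (m + m))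

parity : ∀ n → Parity n
parity zero = even 0
parity (suc n) with parity n
... | even m = odd m
... | odd m  = subst Parity (cong suc (ℕ.+-suc m m)) (even (suc m))

m+m≡m*2 : ∀ m → m + m ≡ m * 2
m+m≡m*2 = solve-∀

double-%2 : ∀ m → (m + m) % 2 ≡ 0
double-%2 m = trans (cong (_% 2) (m+m≡m*2 m)) (m*n%n≡0 m 2)

suc-double-%2 : ∀ m → suc (m + m) % 2 ≡ 1
suc-double-%2 m = trans (cong (λ n → suc n % 2) (m+m≡m*2 m)) ([m+kn]%n≡m%n 1 m 2)

even-double : ∀ m → Even (m + m)
even-double m = m%n≡0⇒n∣m (m + m) 2 (double-%2 m)

odd-double : ∀ m → Odd (suc (m + m))
odd-double m even-m = contradiction (trans (sym (suc-double-%2 m)) (n∣m⇒m%n≡0 (suc (m + m)) 2 even-m)) λ ()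

odd-shape : ∀ {y} → Odd y → ∃ λ m → y ≡ 2 * m + 1
odd-shape {y} odd-y with parity y
... | even m = contradiction (even-double m) odd-y
... | odd m  = m , solve m
  where
  solve : ∀ m → suc (m + m) ≡ 2 * m + 1
  solve = solve-∀

C-double : ∀ m → C (m + m) ≡ m
C-double m rewrite double-%2 m = sym (ℕ.n≡⌊n+n/2⌋ m)

C-suc-double : ∀ m → C (suc (m + m)) ≡ 3 * m + 2
C-suc-double m rewrite suc-double-%2 m =
  trans (cong ⌊_/2⌋ (solve m)) (sym (ℕ.n≡⌊n+n/2⌋ (3 * m + 2)))
  where
  solve : ∀ m → 3 * suc (m + m) + 1 ≡ (3 * m + 2) + (3 * m + 2)
  solve = solve-∀

odd⇒<C : ∀ {y} → Odd y → y < C y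
odd⇒<C {y} odd-y with parity y
... | even m = contradiction (even-double m) odd-y
... | odd m  = subst (suc (m + m) <_) (sym (C-suc-double m))
                 (subst (suc (m + m) <_) (solve m) (ℕ.m≤m+n (2 + (m + m)) m))
  where
  solve : ∀ m → 2 + (m + m) + m ≡ 3 * m + 2
  solve = solve-∀

even⇒C≤ : ∀ {y} → Even y → C y ≤ y
even⇒C≤ {y} even-y with parity y
... | even m = subst (_≤ m + m) (sym (C-double m)) (ℕ.m≤m+n m m)
... | odd m  = contradiction even-y (odd-double m)

even⇒C< : ∀ {y} → Even y → 1 ≤ y → C y < y
even⇒C< {y} even-y y≥1 with parity y
... | even zero    = contradiction y≥1 λ ()
... | even (suc m) = subst (_< suc m + suc m) (sym (C-double (suc m))) (ℕ.m<m+n (suc m) (s≤s z≤n))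
... | odd m        = contradiction even-y (odd-double m)

<C⇔odd : ∀ y → y < C y ⇔ Odd y
<C⇔odd y = mk⇔ (λ y<Cy even-y → ℕ.<⇒≱ y<Cy (even⇒C≤ even-y)) odd⇒<C

C<⇔even : ∀ {y} → 1 ≤ y → C y < y ⇔ Even y
C<⇔even {y} y≥1 = mk⇔ (λ Cy<y → decide Cy<y) (λ even-y → even⇒C< even-y y≥1)
  where
  decide : C y < y → Even y
  decide Cy<y with 2 ∣? y
  ... | yes even-y = even-y
  ... | no odd-y   = contradiction (ℕ.<-trans Cy<y (odd⇒<C odd-y)) (ℕ.<-irrefl refl)

C-pos : ∀ {y} → 1 ≤ y → 1 ≤ C y
C-pos {y} y≥1 with parity y
... | even zero    = contradiction y≥1 λ ()
... | even (suc m) = subst (1 ≤_) (sym (C-double (suc m))) (s≤s z≤n)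
... | odd m        = subst (1 ≤_) (sym (C-suc-double m)) (ℕ.≤-trans (s≤s z≤n) (ℕ.m≤n+m 2 (3 * m)))


iterC-suc : ∀ t x → iterC (suc t) x ≡ C (iterC t x)
iterC-suc zero    x = refl
iterC-suc (suc t) x = iterC-suc t (C x)

iterC-+ : ∀ s t x → iterC (s + t) x ≡ iterC s (iterC t x)
iterC-+ zero    t x = refl
iterC-+ (suc s) t x = begin
  iterC (suc (s + t)) x   ≡⟨ iterC-suc (s + t) x ⟩
  C (iterC (s + t) x)     ≡⟨ cong C (iterC-+ s t x) ⟩
  C (iterC s (iterC t x)) ≡⟨ iterC-suc s (iterC t x) ⟨
  iterC (suc s) (iterC t x) ∎
  where open ≡-Reasoning

iterC-pos : ∀ t {x} → 1 ≤ x → 1 ≤ iterC t x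
iterC-pos zero    x≥1 = x≥1
iterC-pos (suc t) x≥1 = iterC-pos t (C-pos x≥1)

iterC-∸ : ∀ {c t} n → c ≤ t → iterC (t ∸ c) (iterC c n) ≡ iterC t n
iterC-∸ {c} {t} n c≤t = trans (sym (iterC-+ (t ∸ c) c n)) (cong (λ m → iterC m n) (ℕ.m∸n+n≡m c≤t))

iterC-one : ∀ t → iterC t 1 ≡ 1 ⊎ iterC t 1 ≡ 2
iterC-one zero = inj₁ refl
iterC-one (suc t) with iterC-one t
... | inj₁ eq = inj₂ (trans (iterC-suc t 1) (cong C eq))
... | inj₂ eq = inj₁ (trans (iterC-suc t 1) (cong C eq))

module Periodic {n p : ℕ} (per : iterC p n ≡ n) where

  iterC-periodic : ∀ t c → iterC (t + c * p) n ≡ iterC t n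
  iterC-periodic t zero    = cong (λ s → iterC s n) (ℕ.+-identityʳ t)
  iterC-periodic t (suc c) = begin
    iterC (t + (p + c * p)) n     ≡⟨ cong (λ s → iterC s n) (shuffle t p (c * p)) ⟩
    iterC ((t + c * p) + p) n     ≡⟨ iterC-+ (t + c * p) p n ⟩
    iterC (t + c * p) (iterC p n) ≡⟨ cong (iterC (t + c * p)) per ⟩
    iterC (t + c * p) n           ≡⟨ iterC-periodic t c ⟩
    iterC t n                     ∎
    where
    open ≡-Reasoning
    shuffle : ∀ t p q → t + (p + q) ≡ (t + q) + p
    shuffle = solve-∀

  InCycle-iterC : 1 ≤ p → ∀ t → InCycle n p (iterC t n)
  InCycle-iterC (s≤s z≤n) t =
    t % p , m%n<n t p , trans (sym (iterC-periodic (t % p) (t ℕ./ p))) (cong (λ s → iterC s n) (sym (m≡m%n+[m/n]*n t p)))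

  cycle-through-one : 1 ≤ p → ∀ {T} → iterC T n ≡ 1 → ∀ x → InCycle n p x ⇔ (x ≡ 1 ⊎ x ≡ 2)
  cycle-through-one p≥1 {T} reach x = mk⇔ to from
    where
    to : InCycle n p x → x ≡ 1 ⊎ x ≡ 2
    to (t , _ , refl) = subst (λ y → y ≡ 1 ⊎ y ≡ 2) late≡early (iterC-one (t + T * p ∸ T))
      where
      T≤ : T ≤ t + T * p
      T≤ = ℕ.≤-trans (ℕ.m≤m*n T p {{ℕ.>-nonZero p≥1}}) (ℕ.m≤n+m (T * p) t)
      late≡early : iterC (t + T * p ∸ T) 1 ≡ iterC t n
      late≡early = begin
        iterC (t + T * p ∸ T) 1             ≡⟨ cong (iterC (t + T * p ∸ T)) reach ⟨
        iterC (t + T * p ∸ T) (iterC T n)   ≡⟨ iterC-+ (t + T * p ∸ T) T n ⟨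
        iterC (t + T * p ∸ T + T) n         ≡⟨ cong (λ s → iterC s n) (ℕ.m∸n+n≡m T≤) ⟩
        iterC (t + T * p) n                 ≡⟨ iterC-periodic t T ⟩
        iterC t n                           ∎
        where open ≡-Reasoning
    from : x ≡ 1 ⊎ x ≡ 2 → InCycle n p x
    from (inj₁ refl) = subst (InCycle n p) reach (InCycle-iterC p≥1 T)
    from (inj₂ refl) = subst (InCycle n p) (trans (iterC-suc T n) (cong C reach)) (InCycle-iterC p≥1 (suc T))

nontrivial-cycle-above : ∀ {X₀ n p} → IsX0 X₀ → NontrivialCycle n p → ∀ t → X₀ < iterC t n
nontrivial-cycle-above {X₀} {n} {p} (_ , reaches-one) (n≥1 , p≥1 , per , _ , nontrivial) t
  with X₀ ℕ.<? iterC t n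
... | yes above = above
... | no below with reaches-one (iterC t n) (iterC-pos t n≥1) (ℕ.≮⇒≥ below)
... | T , reach = contradiction
  (Periodic.cycle-through-one per p≥1 {T + t} (trans (iterC-+ T t n) reach)) nontrivial

-- Rational estimates

frac≃ : ∀ p q → toℚᵘ ((+ p) / suc q) ℚᵘ.≃ mkℚᵘ (+ p) q
frac≃ p q = ℚ.toℚᵘ-fromℚᵘ (mkℚᵘ (+ p) q)

recip-<-frac : ∀ {X y p q} → suc X * suc q < p * suc y →
               recip (suc y) <ℚ ((+ p) / suc q) ℚ.* recip (suc X)
recip-<-frac {X} {y} {p} {q} cross = ℚ.toℚᵘ-cancel-< (begin-strict
  toℚᵘ (recip (suc y))                                 ≃⟨ frac≃ 1 y ⟩
  mkℚᵘ (+ 1) y                                         <⟨ *<* (subst₂ ℤ._<_ lhs rhs (+<+ cross′)) ⟩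
  mkℚᵘ (+ p) q ℚᵘ.* mkℚᵘ (+ 1) X                       ≃⟨ ℚᵘ.*-cong (frac≃ p q) (frac≃ 1 X) ⟨
  toℚᵘ ((+ p) / suc q) ℚᵘ.* toℚᵘ (recip (suc X))       ≃⟨ ℚ.toℚᵘ-homo-* ((+ p) / suc q) (recip (suc X)) ⟨
  toℚᵘ (((+ p) / suc q) ℚ.* recip (suc X))             ∎)
  where
  open ℚᵘ.≤-Reasoning
  cross′ : suc q * suc X < p * suc y
  cross′ = subst (_< p * suc y) (ℕ.*-comm (suc X) (suc q)) cross
  lhs : + (suc q * suc X) ≡ (+ 1) ℤ.* (+ (suc q * suc X))
  lhs = sym (ℤ.*-identityˡ _)
  rhs : + (p * suc y) ≡ ((+ p) ℤ.* (+ 1)) ℤ.* (+ suc y)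
  rhs = trans (ℤ.pos-* p (suc y)) (cong (ℤ._* (+ suc y)) (sym (ℤ.*-identityʳ (+ p))))

fromℚᵘ-+ : ∀ p q → fromℚᵘ (p ℚᵘ.+ q) ≡ fromℚᵘ p +ℚ fromℚᵘ q
fromℚᵘ-+ p q = ℚ.toℚᵘ-injective (begin
  toℚᵘ (fromℚᵘ (p ℚᵘ.+ q))                   ≈⟨ ℚ.toℚᵘ-fromℚᵘ (p ℚᵘ.+ q) ⟩
  p ℚᵘ.+ q                                   ≈⟨ ℚᵘ.+-cong (ℚ.toℚᵘ-fromℚᵘ p) (ℚ.toℚᵘ-fromℚᵘ q) ⟨
  toℚᵘ (fromℚᵘ p) ℚᵘ.+ toℚᵘ (fromℚᵘ q)       ≈⟨ ℚ.toℚᵘ-homo-+ (fromℚᵘ p) (fromℚᵘ q) ⟨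
  toℚᵘ (fromℚᵘ p +ℚ fromℚᵘ q)                ∎)
  where open ℚᵘ.≃-Reasoning

fromℚᵘ-≤ : ∀ {p q} → p ℚᵘ.≤ toℚᵘ q → fromℚᵘ p ℚ.≤ q
fromℚᵘ-≤ {p} {q} p≤q = ℚ.toℚᵘ-cancel-≤ (ℚᵘ.≤-respˡ-≃ (ℚᵘ.≃-sym (ℚ.toℚᵘ-fromℚᵘ p)) p≤q)

threeQuarters : ℕ → ℚ
threeQuarters K = (+ K) / 1 ℚ.* ((+ 3) / 4)

threeQuarters≃ : ∀ K → toℚᵘ (threeQuarters K) ℚᵘ.≃ mkℚᵘ (+ K) 0 ℚᵘ.* mkℚᵘ (+ 3) 3
threeQuarters≃ K = ℚᵘ.≃-trans (ℚ.toℚᵘ-homo-* ((+ K) / 1) ((+ 3) / 4)) (ℚᵘ.*-cong (frac≃ K 0) (frac≃ 3 3))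

/1-homo-+ : ∀ m n → (+ (m + n)) / 1 ≡ (+ m) / 1 +ℚ (+ n) / 1
/1-homo-+ m n = ℚ.toℚᵘ-injective (begin
  toℚᵘ ((+ (m + n)) / 1)                 ≈⟨ frac≃ (m + n) 0 ⟩
  mkℚᵘ (+ (m + n)) 0                     ≈⟨ *≡* numerators ⟩
  mkℚᵘ (+ m) 0 ℚᵘ.+ mkℚᵘ (+ n) 0         ≈⟨ ℚᵘ.+-cong (frac≃ m 0) (frac≃ n 0) ⟨
  toℚᵘ ((+ m) / 1) ℚᵘ.+ toℚᵘ ((+ n) / 1) ≈⟨ ℚ.toℚᵘ-homo-+ ((+ m) / 1) ((+ n) / 1) ⟨
  toℚᵘ ((+ m) / 1 +ℚ (+ n) / 1)          ∎)
  where
  open ℚᵘ.≃-Reasoning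
  numerators : (+ (m + n)) ℤ.* (+ 1) ≡ ((+ m) ℤ.* (+ 1) ℤ.+ (+ n) ℤ.* (+ 1)) ℤ.* (+ 1)
  numerators rewrite ℤ.*-identityʳ (+ m) | ℤ.*-identityʳ (+ n) = cong (ℤ._* (+ 1)) (ℤ.pos-+ m n)

bound-+ : ∀ X m n → bound X (m + n) ≡ bound X m +ℚ bound X n
bound-+ X m n = begin
  ((+ (m + n)) / 1 ℚ.* ¾) ℚ.* r                  ≡⟨ cong (λ k → (k ℚ.* ¾) ℚ.* r) (/1-homo-+ m n) ⟩
  (((+ m) / 1 +ℚ (+ n) / 1) ℚ.* ¾) ℚ.* r         ≡⟨ cong (ℚ._* r) (ℚ.*-distribʳ-+ ¾ ((+ m) / 1) ((+ n) / 1)) ⟩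
  ((+ m) / 1 ℚ.* ¾ +ℚ (+ n) / 1 ℚ.* ¾) ℚ.* r     ≡⟨ ℚ.*-distribʳ-+ r ((+ m) / 1 ℚ.* ¾) ((+ n) / 1 ℚ.* ¾) ⟩
  bound X m +ℚ bound X n                          ∎
  where
  open ≡-Reasoning
  ¾ = (+ 3) / 4
  r = recip X

recip-nonNeg : ∀ X → ℚ.NonNegative (recip X)
recip-nonNeg zero    = _
recip-nonNeg (suc X) = ℚ.pos⇒nonNeg (recip (suc X)) {{ℚ.normalize-pos 1 (suc X)}}

-- c weighs the first K terms of a run of length k; each of the extra k ∸ K terms costs at most (3/4)/X₀.
record RunBound (X₀ : ℕ) (q : ℚ) (k : ℕ) (c : ℚ) (K : ℕ) : Set where
  constructor runBound
  field
    extra    : ℕ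
    length≡  : k ≡ K + extra
    estimate : q <ℚ c ℚ.* recip X₀ +ℚ bound X₀ extra

RunBound-+ : ∀ {X₀ q k c K q′ k′ c′ K′} → RunBound X₀ q k c K → RunBound X₀ q′ k′ c′ K′ →
             RunBound X₀ (q +ℚ q′) (k + k′) (c +ℚ c′) (K + K′)
RunBound-+ {X₀} {c = c} {K} {c′ = c′} {K′} (runBound J refl q<) (runBound J′ refl q′<) =
  runBound (J + J′) (regroup K J K′ J′) $
  subst (_ <ℚ_) (begin
    (c ℚ.* r +ℚ bound X₀ J) +ℚ (c′ ℚ.* r +ℚ bound X₀ J′)
      ≡⟨ interchange (c ℚ.* r) (bound X₀ J) (c′ ℚ.* r) (bound X₀ J′) ⟩
    (c ℚ.* r +ℚ c′ ℚ.* r) +ℚ (bound X₀ J +ℚ bound X₀ J′)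
      ≡⟨ cong₂ _+ℚ_ (ℚ.*-distribʳ-+ r c c′) (bound-+ X₀ J J′) ⟨
    (c +ℚ c′) ℚ.* r +ℚ bound X₀ (J + J′)                  ∎)
    (ℚ.+-mono-< q< q′<)
  where
  open ≡-Reasoning
  r = recip X₀
  regroup : ∀ K J K′ J′ → (K + J) + (K′ + J′) ≡ (K + K′) + (J + J′)
  regroup = solve-∀

RunBound⇒< : ∀ {X₀ q k c K} → RunBound X₀ q k c K → c ℚ.≤ threeQuarters K → q <ℚ bound X₀ k
RunBound⇒< {X₀} {c = c} {K} (runBound J refl q<) c≤ = begin-strict
  _                                 <⟨ q< ⟩
  c ℚ.* recip X₀ +ℚ bound X₀ J
    ≤⟨ ℚ.+-monoˡ-≤ (bound X₀ J) (ℚ.*-monoʳ-≤-nonNeg (recip X₀) {{recip-nonNeg X₀}} c≤) ⟩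
  bound X₀ K +ℚ bound X₀ J          ≡⟨ bound-+ X₀ K J ⟨
  bound X₀ (K + J)                  ∎
  where open ℚ.≤-Reasoning

odd-run-increasing : ∀ {x k} → IsK x k → ∀ i → 1 ≤ i → i < k → C x ≤ iterC i x
odd-run-increasing run (suc zero)    _ _   = ℕ.≤-refl
odd-run-increasing {x} run@(_ , odds , _) (suc (suc i)) _ i<k = ℕ.≤-trans
  (odd-run-increasing run (suc i) (s≤s z≤n) (ℕ.<-trans (ℕ.n<1+n (suc i)) i<k))
  (subst (iterC (suc i) x ≤_) (sym (iterC-suc (suc i) x))
         (ℕ.<⇒≤ (odd⇒<C (odds (suc i) (ℕ.<-trans (ℕ.n<1+n (suc i)) i<k)))))

IsK-≥ : ∀ {y k K} → IsK y k → (∀ j → j < K → Odd (iterC j y)) → K ≤ k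
IsK-≥ (_ , _ , even-k) odds = ℕ.≮⇒≥ (λ k<K → odds _ k<K even-k)

-- Beyond its first term, an odd run from 2m + 1 > X₀ stays at least C(2m + 1) = 3m + 2 > (4/3) X₀.
odd-run-term : ∀ {X₀ x k} → 1 ≤ X₀ → X₀ < x → IsK x k → ∀ i → 1 ≤ i → i < k →
               recip (iterC i x) <ℚ ((+ 3) / 4) ℚ.* recip X₀
odd-run-term {suc X} {x} _ X<x run@(k≥1 , odds , _) i i≥1 i<k with parity x
... | even m = contradiction (even-double m) (odds 0 k≥1)
... | odd m  = recip-below (iterC i x) Cx≤
  where
  Cx≤ : 3 * m + 2 ≤ iterC i x
  Cx≤ = subst (_≤ iterC i x) (C-suc-double m) (odd-run-increasing run i i≥1 i<k)
  cross : ∀ {y} → 3 * m + 2 ≤ y → suc X * 4 < 3 * y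
  cross {y} le = begin-strict
    suc X * 4           ≤⟨ ℕ.*-monoˡ-≤ 4 (ℕ.m<1+n⇒m≤n X<x) ⟩
    (m + m) * 4         <⟨ ℕ.m<m+n ((m + m) * 4) (ℕ.≤-trans (s≤s z≤n) (ℕ.m≤n+m 6 m)) ⟩
    (m + m) * 4 + (m + 6) ≡⟨ solve m ⟩
    3 * (3 * m + 2)     ≤⟨ ℕ.*-monoʳ-≤ 3 le ⟩
    3 * y               ∎
    where
    open ℕ.≤-Reasoning
    solve : ∀ m → (m + m) * 4 + (m + 6) ≡ 3 * (3 * m + 2)
    solve = solve-∀
  recip-below : ∀ y → 3 * m + 2 ≤ y → recip y <ℚ ((+ 3) / 4) ℚ.* recip (suc X)
  recip-below zero    le = contradiction (ℕ.≤-trans (ℕ.m≤n+m 2 (3 * m)) le) λ ()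
  recip-below (suc y) le = recip-<-frac {X} {y} {3} {3} (cross le)

T-tail : ∀ {X₀ x k K} → 1 ≤ X₀ → X₀ < x → IsK x k → 1 ≤ K → ∀ J → J + K ≤ k →
         T x (J + K) ℚ.≤ T x K +ℚ bound X₀ J
T-tail {X₀} {x} {K = K} _ _ _ _ zero _ = begin
  T x K                  ≡⟨ ℚ.+-identityʳ (T x K) ⟨
  T x K +ℚ 0ℚ            ≡⟨ cong (T x K +ℚ_) (ℚ.*-zeroˡ (recip X₀)) ⟨
  T x K +ℚ bound X₀ 0    ∎
  where open ℚ.≤-Reasoning
T-tail {X₀} {x} {K = K} X₀≥1 X<x run K≥1 (suc J) J+K<k = begin
  T x (J + K) +ℚ recip (iterC (J + K) x)                 ≤⟨ ℚ.+-mono-≤ (T-tail X₀≥1 X<x run K≥1 J (ℕ.<⇒≤ J+K<k))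
                                                              (ℚ.<⇒≤ (odd-run-term X₀≥1 X<x run (J + K)
                                                                        (ℕ.≤-trans K≥1 (ℕ.m≤n+m K J)) J+K<k)) ⟩
  (T x K +ℚ bound X₀ J) +ℚ ((+ 3) / 4) ℚ.* recip X₀      ≡⟨ ℚ.+-assoc (T x K) (bound X₀ J) _ ⟩
  T x K +ℚ (bound X₀ J +ℚ ((+ 3) / 4) ℚ.* recip X₀)      ≡⟨⟩
  T x K +ℚ (bound X₀ J +ℚ bound X₀ 1)                    ≡⟨ cong (T x K +ℚ_) (bound-+ X₀ J 1) ⟨
  T x K +ℚ bound X₀ (J + 1)                              ≡⟨ cong (λ j → T x K +ℚ bound X₀ j) (ℕ.+-comm J 1) ⟩
  T x K +ℚ bound X₀ (suc J)                              ∎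
  where open ℚ.≤-Reasoning

IsNext : (ℕ → Set) → ℕ → ℕ → Set
IsNext P d d′ = d < d′ × P d′ × (∀ t → d < t → t < d′ → ¬ P t)

IsNext-unique : ∀ {P d d₁ d₂} → IsNext P d d₁ → IsNext P d d₂ → d₁ ≡ d₂
IsNext-unique (d<d₁ , P₁ , none₁) (d<d₂ , P₂ , none₂) with ℕ.<-cmp _ _
... | tri< d₁<d₂ _ _ = contradiction P₁ (none₂ _ d<d₁ d₁<d₂)
... | tri≈ _ eq _    = eq
... | tri> _ _ d₂<d₁ = contradiction P₂ (none₁ _ d<d₂ d₂<d₁)

IsNext-cong : ∀ {P Q d d′} → (∀ t → d < t → t ≤ d′ → P t ⇔ Q t) → IsNext P d d′ → IsNext Q d d′
IsNext-cong P⇔Q (d<d′ , P-d′ , none) =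
  d<d′ , Equivalence.to (P⇔Q _ d<d′ ℕ.≤-refl) P-d′ ,
  λ t d<t t<d′ Q-t → none t d<t t<d′ (Equivalence.from (P⇔Q t d<t (ℕ.<⇒≤ t<d′)) Q-t)

IsNext-relative : ∀ {P c d d′} → c ≤ d → IsNext P d d′ → IsNext (λ t → P (t + c)) (d ∸ c) (d′ ∸ c)
IsNext-relative {P} {c} {d} {d′} c≤d (d<d′ , P-d′ , none) =
  ℕ.∸-monoˡ-< d<d′ c≤d ,
  subst P (sym (ℕ.m∸n+n≡m c≤d′)) P-d′ ,
  λ t below above → none (t + c) (lift-below below) (lift-above above)
  where
  c≤d′ : c ≤ d′
  c≤d′ = ℕ.≤-trans c≤d (ℕ.<⇒≤ d<d′)
  lift-below : ∀ {t} → d ∸ c < t → d < t + c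
  lift-below {t} below = subst (_< t + c) (ℕ.m∸n+n≡m c≤d) (ℕ.+-monoˡ-< c below)
  lift-above : ∀ {t} → t < d′ ∸ c → t + c < d′
  lift-above {t} above = subst (t + c <_) (ℕ.m∸n+n≡m c≤d′) (ℕ.+-monoˡ-< c above)

firstFrom : (ℕ → Bool) → ℕ → ℕ → Maybe ℕ
firstFrom p d zero    = nothing
firstFrom p d (suc n) = if p d then just d else firstFrom p (suc d) n

firstFrom-sound : ∀ p d n {t} → firstFrom p (suc d) n ≡ just t → IsNext (Bool.T ∘ p) d t × t < suc d + n
firstFrom-sound p d (suc n) {t} found with p (suc d) in p-d
firstFrom-sound p d (suc n) refl | true =
  (ℕ.n<1+n d , subst Bool.T (sym p-d) _ , λ s d<s s<t → contradiction s<t (ℕ.≤⇒≯ d<s)) ,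
  ℕ.m<m+n (suc d) (s≤s z≤n)
firstFrom-sound p d (suc n) {t} found | false =
  let (d<t , p-t , none) , t< = firstFrom-sound p (suc d) n found
  in (ℕ.<-trans (ℕ.n<1+n d) d<t , p-t , extend none) ,
     subst (t <_) (sym (ℕ.+-suc (suc d) n)) t<
  where
  extend : ∀ {t} → (∀ s → suc d < s → s < t → ¬ Bool.T (p s)) → ∀ s → d < s → s < t → ¬ Bool.T (p s)
  extend none s d<s s<t with ℕ.m≤n⇒m<n∨m≡n d<s
  ... | inj₁ suc-d<s = none s suc-d<s s<t
  ... | inj₂ refl    = subst (λ b → ¬ Bool.T b) (sym p-d) (λ ())

-- Affine residue classes

infix 5 _·u+_

record Affine : Set where
  constructor _·u+_
  field
    slope offset : ℕ
open Affine

⟦_⟧ : Affine → ℕ → ℕ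
⟦ s ·u+ b ⟧ u = s * u + b

isOdd : ℕ → Bool
isOdd b = b % 2 ≡ᵇ 1

C-affine : Affine → Affine
C-affine (s ·u+ b) = s ℕ./ 2 * (if isOdd b then 3 else 1) ·u+ C b

orbit : ℕ → Affine → Affine
orbit zero    f = f
orbit (suc t) f = orbit t (C-affine f)

halvable : ℕ → Bool
halvable s = (s % 2 ≡ᵇ 0) ∧ (0 ℕ.<ᵇ s)

AffineFor : ℕ → Affine → Bool
AffineFor zero    f = true
AffineFor (suc a) f = halvable (slope f) ∧ AffineFor a (C-affine f)

isOdd-double : ∀ m → isOdd (m + m) ≡ false
isOdd-double m rewrite double-%2 m = refl

isOdd-suc-double : ∀ m → isOdd (suc (m + m)) ≡ true
isOdd-suc-double m rewrite suc-double-%2 m = refl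

isOdd-pos : ∀ b → isOdd b ≡ true → 1 ≤ b
isOdd-pos (suc b) _ = s≤s z≤n

half-double : ∀ m → (m + m) ℕ./ 2 ≡ m
half-double m = trans (cong (ℕ._/ 2) (m+m≡m*2 m)) (m*n/n≡m m 2)

⟦⟧-double : ∀ h c u → (h + h) * u + (c + c) ≡ (h * u + c) + (h * u + c)
⟦⟧-double = solve-∀

⟦⟧-suc-double : ∀ h c u → (h + h) * u + suc (c + c) ≡ suc ((h * u + c) + (h * u + c))
⟦⟧-suc-double = solve-∀

C-⟦⟧ : ∀ {s} b u → Even s → C (⟦ s ·u+ b ⟧ u) ≡ ⟦ C-affine (s ·u+ b) ⟧ u
C-⟦⟧ {s} b u even-s with parity s | parity b
... | odd h  | _      = contradiction even-s (odd-double h)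
... | even h | even c rewrite half-double h | isOdd-double c | C-double c = begin
  C ((h + h) * u + (c + c))      ≡⟨ cong C (⟦⟧-double h c u) ⟩
  C ((h * u + c) + (h * u + c))  ≡⟨ C-double (h * u + c) ⟩
  h * u + c                      ≡⟨ cong (λ k → k * u + c) (ℕ.*-identityʳ h) ⟨
  h * 1 * u + c                  ∎
  where open ≡-Reasoning
... | even h | odd c rewrite half-double h | isOdd-suc-double c | C-suc-double c = begin
  C ((h + h) * u + suc (c + c))        ≡⟨ cong C (⟦⟧-suc-double h c u) ⟩
  C (suc ((h * u + c) + (h * u + c)))  ≡⟨ C-suc-double (h * u + c) ⟩
  3 * (h * u + c) + 2                  ≡⟨ spread h c u ⟩
  h * 3 * u + (3 * c + 2)              ∎
  where
  open ≡-Reasoning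
  spread : ∀ h c u → 3 * (h * u + c) + 2 ≡ h * 3 * u + (3 * c + 2)
  spread = solve-∀

isOdd⇔Odd : ∀ {s} b u → Even s → isOdd b ≡ true ⇔ Odd (⟦ s ·u+ b ⟧ u)
isOdd⇔Odd {s} b u even-s with parity s | parity b
... | odd h  | _      = contradiction even-s (odd-double h)
... | even h | even c rewrite isOdd-double c =
  mk⇔ (λ ()) (contradiction (subst Even (sym (⟦⟧-double h c u)) (even-double (h * u + c))))
... | even h | odd c rewrite isOdd-suc-double c =
  mk⇔ (λ _ → subst Odd (sym (⟦⟧-suc-double h c u)) (odd-double (h * u + c))) (λ _ → refl)

halvable-sound : ∀ s → Bool.T (halvable s) → Even s × 1 ≤ s
halvable-sound s ok =
  let even-s , pos-s = Equivalence.to (Bool.T-∧ {s % 2 ≡ᵇ 0}) ok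
  in m%n≡0⇒n∣m s 2 (ℕ.≡ᵇ⇒≡ (s % 2) 0 even-s) , ℕ.<ᵇ⇒< 0 s pos-s

AffineFor-suc : ∀ {a f} → Bool.T (AffineFor (suc a) f) →
                Even (slope f) × 1 ≤ slope f × Bool.T (AffineFor a (C-affine f))
AffineFor-suc {a} {f} valid =
  let ok , valid′ = Equivalence.to (Bool.T-∧ {halvable (slope f)}) valid
      even-s , pos-s = halvable-sound (slope f) ok
  in even-s , pos-s , valid′

orbit-⟦⟧ : ∀ {a f} t u → Bool.T (AffineFor a f) → t ≤ a → iterC t (⟦ f ⟧ u) ≡ ⟦ orbit t f ⟧ u
orbit-⟦⟧ zero u _ _ = refl
orbit-⟦⟧ {suc a} {f} (suc t) u valid (s≤s t≤a) =
  let even-s , _ , valid′ = AffineFor-suc {a} {f} valid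
  in trans (cong (iterC t) (C-⟦⟧ (offset f) u even-s)) (orbit-⟦⟧ t u valid′ t≤a)

slope-orbit : ∀ {a f} t → Bool.T (AffineFor a f) → t < a → Even (slope (orbit t f)) × 1 ≤ slope (orbit t f)
slope-orbit {suc a} {f} zero valid _ = let even-s , pos-s , _ = AffineFor-suc {a} {f} valid in even-s , pos-s
slope-orbit {suc a} {f} (suc t) valid (s≤s t<a) = slope-orbit t (proj₂ (proj₂ (AffineFor-suc {a} {f} valid))) t<a

ratioᵘ : ℕ → ℕ → ℚᵘ
ratioᵘ p zero    = ℚᵘ.0ℚᵘ
ratioᵘ p (suc q) = mkℚᵘ (+ p) q

-- Since X < G u + H forces X ≤ G u + (H ∸ 1), this ratio p/(A B) satisfies X·A B < p·(A u + B).
-- Weights are evaluated by the type checker: ⊔′ avoids the unary _⊔_ and ℚᵘ avoids gcd normalisation.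
weight : Affine → Affine → ℚᵘ
weight (A ·u+ B) (G ·u+ H) = ratioᵘ (G * B ⊔′ suc ((H ∸ 1) * A)) (A * B)

weight-cross : ∀ {X A G H u} B → .{{NonZero B}} → X < G * u + H →
               X * (A * B) < (G * B ℕ.⊔ suc ((H ∸ 1) * A)) * (A * u + B)
weight-cross {X} {A} {G} {H} {u} B X< = begin-strict
  X * (A * B)                        ≤⟨ ℕ.*-monoˡ-≤ (A * B) (below H X<) ⟩
  (G * u + (H ∸ 1)) * (A * B)        ≡⟨ regroup G u (H ∸ 1) A B ⟩
  G * B * (A * u) + (H ∸ 1) * A * B  <⟨ ℕ.+-mono-≤-< (ℕ.*-monoˡ-≤ (A * u) (ℕ.m≤m⊔n (G * B) _))
                                                     (ℕ.*-monoˡ-< B (ℕ.m≤n⊔m (G * B) (suc ((H ∸ 1) * A)))) ⟩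
  p * (A * u) + p * B                ≡⟨ ℕ.*-distribˡ-+ p (A * u) B ⟨
  p * (A * u + B)                    ∎
  where
  open ℕ.≤-Reasoning
  p = G * B ℕ.⊔ suc ((H ∸ 1) * A)
  below : ∀ H → X < G * u + H → X ≤ G * u + (H ∸ 1)
  below zero    X< = ℕ.<⇒≤ X<
  below (suc h) X< = ℕ.m<1+n⇒m≤n (subst (X <_) (ℕ.+-suc (G * u) h) X<)
  regroup : ∀ G u h A B → (G * u + h) * (A * B) ≡ G * B * (A * u) + h * A * B
  regroup = solve-∀

recip-<-weight : ∀ {X A B G H u} → 1 ≤ X → 1 ≤ A → 1 ≤ B → X < ⟦ G ·u+ H ⟧ u →
                 recip (⟦ A ·u+ B ⟧ u) <ℚ fromℚᵘ (weight (A ·u+ B) (G ·u+ H)) ℚ.* recip X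
recip-<-weight {suc X} {suc A} {suc B} {G} {H} {u} _ _ _ X< =
  subst (λ y → recip y <ℚ fromℚᵘ (weight (suc A ·u+ suc B) (G ·u+ H)) ℚ.* recip (suc X))
        (sym (ℕ.+-suc (suc A * u) B)) (recip-<-frac {X} {suc A * u + B} {G * suc B ⊔′ suc ((H ∸ 1) * suc A)} {B + A * suc B} cross)
  where
  cross : suc X * (suc A * suc B) < (G * suc B ⊔′ suc ((H ∸ 1) * suc A)) * suc (suc A * u + B)
  cross = subst₂ (λ p y → suc X * (suc A * suc B) < p * y)
                 (ℕ.⊔≡⊔′ (G * suc B) (suc ((H ∸ 1) * suc A))) (ℕ.+-suc (suc A * u) B)
                 (weight-cross {suc X} {suc A} {G} {H} {u} (suc B) X<)

-- For x = f u with AffineFor a f, C^t x = orbit t f u for t ≤ a, so the parities of C^t x for t < a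
-- are known; each term of an odd run visible in this window is weighted against C^e x > X₀.
module Window (a : ℕ) (f : Affine) (e : ℕ) where

  oddAt : ℕ → Bool
  oddAt t = isOdd (offset (orbit t f))

  minAt : ℕ → Bool
  minAt t = not (oddAt (pred t)) ∧ oddAt t

  nextMin : ℕ → Maybe ℕ
  nextMin d = firstFrom minAt (suc d) (a ∸ suc d)

  oddRun : ℕ → ℕ → ℕ
  oddRun d zero    = 0
  oddRun d (suc n) = if oddAt d then suc (oddRun (suc d) n) else 0

  runLength : ℕ → ℕ
  runLength d = oddRun d (a ∸ d)

  weightSum : ℕ → ℕ → ℚᵘ
  weightSum d zero    = ℚᵘ.0ℚᵘ
  weightSum d (suc j) = weightSum d j ℚᵘ.+ weight (orbit (j + d) f) (orbit e f)

  runWeight : ℕ → ℚᵘ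
  runWeight d = weightSum d (runLength d)

  fits : ℚᵘ → ℕ → Bool
  fits w K = w ℚᵘ.≤ᵇ mkℚᵘ (+ K) 0 ℚᵘ.* mkℚᵘ (+ 3) 3

  oneRun : Bool
  oneRun = fits (runWeight 0) (runLength 0)

  twoRuns : Bool
  twoRuns with nextMin 0
  ... | nothing = false
  ... | just d₁ = fits (runWeight 0 ℚᵘ.+ runWeight d₁) (runLength 0 + runLength d₁)

  threeRuns : Bool
  threeRuns with nextMin 0
  ... | nothing = false
  ... | just d₁ with nextMin d₁
  ... | nothing = false
  ... | just d₂ = fits (runWeight 0 ℚᵘ.+ runWeight d₁ ℚᵘ.+ runWeight d₂)
                       (runLength 0 + runLength d₁ + runLength d₂)

  someRunsFit : Bool
  someRunsFit = oneRun ∨ twoRuns ∨ threeRuns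

data Cover : Set where
  leaf  : Cover
  split : Cover → Cover → Cover

-- The reference element is x itself or the last affine step C^a x.
covered : ℕ → Affine → Cover → Bool
covered a f leaf = AffineFor a f ∧ (Window.someRunsFit a f 0 ∨ Window.someRunsFit a f a)
covered a (A ·u+ R) (split c₀ c₁) = covered (suc a) (2 * A ·u+ R) c₀ ∧ covered (suc a) (2 * A ·u+ (A + R)) c₁

residue-tree : Cover
residue-tree =
  split leaf
    (split (split leaf
                  (split leaf
                         (split (split leaf leaf)
                                (split leaf
                                       (split leaf
                                              (split (split leaf leaf) leaf))))))
           leaf)

odd-residues-covered : Bool.T (covered 1 (2 ·u+ 1) residue-tree)
odd-residues-covered = tt

-- For t ≥ 1: C^t x is a local minimum of the orbit of x (see LocalMinAt⇔EvenOddAt).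
EvenOddAt : ℕ → ℕ → Set
EvenOddAt x t = Even (iterC (pred t) x) × Odd (iterC t x)

MinimaBound : ℕ → ℕ → ℕ → ℕ → ℕ → ℕ → ℕ → Set
MinimaBound X₀ x y z k₀ k₁ k₂ =
  (T x k₀ <ℚ bound X₀ k₀)
  ⊎ ((T x k₀ +ℚ T y k₁) <ℚ bound X₀ (k₀ + k₁))
  ⊎ ((T x k₀ +ℚ T y k₁ +ℚ T z k₂) <ℚ bound X₀ (k₀ + k₁ + k₂))

module MinimaBounds
  {X₀ x : ℕ} (X₀≥1 : 1 ≤ X₀) (above : ∀ t → X₀ < iterC t x)
  {D₁ D₂ : ℕ} (next₁ : IsNext (EvenOddAt x) 0 D₁) (next₂ : IsNext (EvenOddAt x) D₁ D₂)
  {k₀ k₁ k₂ : ℕ} (run₀ : IsK x k₀) (run₁ : IsK (iterC D₁ x) k₁) (run₂ : IsK (iterC D₂ x) k₂)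
  where

  module WindowSoundness {a : ℕ} {f : Affine} {e u : ℕ}
                         (a≥1 : 1 ≤ a) (valid : Bool.T (AffineFor a f)) (e≤a : e ≤ a) (x≡ : x ≡ ⟦ f ⟧ u) where
    open Window a f e

    orbit-at : ∀ t → t ≤ a → iterC t x ≡ ⟦ orbit t f ⟧ u
    orbit-at t t≤a = trans (cong (iterC t) x≡) (orbit-⟦⟧ t u valid t≤a)

    oddAt⇔ : ∀ t → t < a → oddAt t ≡ true ⇔ Odd (iterC t x)
    oddAt⇔ t t<a = subst (λ y → oddAt t ≡ true ⇔ Odd y) (sym (orbit-at t (ℕ.<⇒≤ t<a)))
                         (isOdd⇔Odd (offset (orbit t f)) u (proj₁ (slope-orbit t valid t<a)))

    evenAt : ∀ t → t < a → oddAt t ≡ false → Even (iterC t x)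
    evenAt t t<a not-odd with 2 ∣? iterC t x
    ... | yes even-t = even-t
    ... | no odd-t   = contradiction (trans (sym not-odd) (Equivalence.from (oddAt⇔ t t<a) odd-t)) λ ()

    pred< : ∀ {t} → t < a → pred t < a
    pred< = ℕ.≤-<-trans ℕ.pred[n]≤n

    minAt⇔ : ∀ t → t < a → Bool.T (minAt t) ⇔ EvenOddAt x t
    minAt⇔ t t<a with oddAt (pred t) in odd-pred | oddAt t in odd-t
    ... | false | true  = mk⇔ (λ _ → evenAt (pred t) (pred< t<a) odd-pred , Equivalence.to (oddAt⇔ t t<a) odd-t)
                              (λ _ → tt)
    ... | true  | _     = mk⇔ (λ ()) (λ (even-pred , _) → Equivalence.to (oddAt⇔ (pred t) (pred< t<a)) odd-pred even-pred)
    ... | false | false = mk⇔ (λ ()) (λ (_ , odd-val) →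
                            contradiction (trans (sym odd-t) (Equivalence.from (oddAt⇔ t t<a) odd-val)) λ ())

    nextMin-sound : ∀ d {d′} → nextMin d ≡ just d′ → IsNext (EvenOddAt x) d d′ × d′ < a
    nextMin-sound d {d′} found =
      IsNext-cong (λ t _ t≤d′ → minAt⇔ t (ℕ.≤-<-trans t≤d′ d′<a)) next , d′<a
      where
      next = proj₁ (firstFrom-sound minAt d (a ∸ suc d) found)
      d′<a : d′ < a
      d′<a with suc d ℕ.≤? a | proj₂ (firstFrom-sound minAt d (a ∸ suc d) found)
      ... | yes d<a | d′< = subst (d′ <_) (ℕ.m+[n∸m]≡n d<a) d′<
      ... | no d≮a  | d′< = contradiction (proj₁ next) (ℕ.≤⇒≯ (ℕ.m<1+n⇒m≤n (subst (d′ <_) empty d′<)))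
        where
        empty : suc d + (a ∸ suc d) ≡ suc d
        empty = trans (cong (λ n → suc d + n) (ℕ.m≤n⇒m∸n≡0 (ℕ.<⇒≤ (ℕ.≰⇒> d≮a)))) (ℕ.+-identityʳ (suc d))

    oddRun-odd : ∀ d n j → j < oddRun d n → oddAt (j + d) ≡ true
    oddRun-odd d (suc n) j j< with oddAt d in odd-d
    oddRun-odd d (suc n) zero    _        | true = odd-d
    oddRun-odd d (suc n) (suc j) (s≤s j<) | true =
      subst (λ t → oddAt t ≡ true) (ℕ.+-suc j d) (oddRun-odd (suc d) n j j<)

    oddRun-≤ : ∀ d n → oddRun d n ≤ n
    oddRun-≤ d zero    = z≤n
    oddRun-≤ d (suc n) with oddAt d
    ... | true  = s≤s (oddRun-≤ (suc d) n)
    ... | false = z≤n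

    oddRun-pos : ∀ d n → 1 ≤ n → oddAt d ≡ true → 1 ≤ oddRun d n
    oddRun-pos d (suc n) _ odd-d rewrite odd-d = s≤s z≤n

    run-within : ∀ d j → d ≤ a → j < runLength d → j + d < a
    run-within d j d≤a j< =
      subst (j + d <_) (ℕ.m∸n+n≡m d≤a) (ℕ.+-monoˡ-< d (ℕ.<-≤-trans j< (oddRun-≤ d (a ∸ d))))

    run-odd : ∀ d j → d ≤ a → j < runLength d → Odd (iterC j (iterC d x))
    run-odd d j d≤a j< = subst Odd (iterC-+ j d x)
      (Equivalence.to (oddAt⇔ (j + d) (run-within d j d≤a j<)) (oddRun-odd d (a ∸ d) j j<))

    term-bound : ∀ d j → d ≤ a → j < runLength d →
                 recip (iterC j (iterC d x)) <ℚ fromℚᵘ (weight (orbit (j + d) f) (orbit e f)) ℚ.* recip X₀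
    term-bound d j d≤a j< =
      subst (λ y → recip y <ℚ _) (trans (sym (orbit-at (j + d) (ℕ.<⇒≤ j+d<a))) (iterC-+ j d x))
        (recip-<-weight {X₀} {slope y} {offset y} {slope (orbit e f)} {offset (orbit e f)} {u}
          X₀≥1 (proj₂ (slope-orbit (j + d) valid j+d<a))
          (isOdd-pos (offset y) (oddRun-odd d (a ∸ d) j j<))
          (subst (X₀ <_) (orbit-at e e≤a) (above e)))
      where
      y = orbit (j + d) f
      j+d<a = run-within d j d≤a j<

    weightSum-suc : ∀ d K → fromℚᵘ (weightSum d (suc K)) ℚ.* recip X₀ ≡
                    fromℚᵘ (weightSum d K) ℚ.* recip X₀ +ℚ fromℚᵘ (weight (orbit (K + d) f) (orbit e f)) ℚ.* recip X₀
    weightSum-suc d K = trans (cong (ℚ._* recip X₀) (fromℚᵘ-+ (weightSum d K) w))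
                              (ℚ.*-distribʳ-+ (recip X₀) (fromℚᵘ (weightSum d K)) (fromℚᵘ w))
      where w = weight (orbit (K + d) f) (orbit e f)

    T-≤-weightSum : ∀ d K → d ≤ a → K ≤ runLength d → T (iterC d x) K ℚ.≤ fromℚᵘ (weightSum d K) ℚ.* recip X₀
    T-<-weightSum : ∀ d K → d ≤ a → 1 ≤ K → K ≤ runLength d →
                    T (iterC d x) K <ℚ fromℚᵘ (weightSum d K) ℚ.* recip X₀

    T-≤-weightSum d zero    _   _  = ℚ.≤-reflexive (sym (ℚ.*-zeroˡ (recip X₀)))
    T-≤-weightSum d (suc K) d≤a K< = ℚ.<⇒≤ (T-<-weightSum d (suc K) d≤a (s≤s z≤n) K<)

    T-<-weightSum d (suc K) d≤a _ K< = subst (_ <ℚ_) (sym (weightSum-suc d K))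
      (ℚ.+-mono-≤-< (T-≤-weightSum d K d≤a (ℕ.<⇒≤ K<)) (term-bound d K d≤a K<))

    run-bound : ∀ d {k} → d < a → IsK (iterC d x) k →
                RunBound X₀ (T (iterC d x) k) k (fromℚᵘ (runWeight d)) (runLength d)
    run-bound d {k} d<a run@(k≥1 , odds , _) = runBound J k≡K+J (begin-strict
      T y k                          ≡⟨ cong (T y) J+K≡k ⟨
      T y (J + K)                    ≤⟨ T-tail X₀≥1 (above d) run K≥1 J (ℕ.≤-reflexive J+K≡k) ⟩
      T y K +ℚ bound X₀ J            <⟨ ℚ.+-monoˡ-< (bound X₀ J) (T-<-weightSum d K (ℕ.<⇒≤ d<a) K≥1 ℕ.≤-refl) ⟩
      fromℚᵘ (runWeight d) ℚ.* recip X₀ +ℚ bound X₀ J ∎)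
      where
      open ℚ.≤-Reasoning
      y = iterC d x
      K = runLength d
      J = k ∸ K
      k≡K+J : k ≡ K + J
      k≡K+J = sym (ℕ.m+[n∸m]≡n (IsK-≥ run (λ j j< → run-odd d j (ℕ.<⇒≤ d<a) j<)))
      J+K≡k : J + K ≡ k
      J+K≡k = trans (ℕ.+-comm J K) (sym k≡K+J)
      K≥1 : 1 ≤ K
      K≥1 = oddRun-pos d (a ∸ d) (ℕ.m<n⇒0<n∸m d<a)
              (Equivalence.from (oddAt⇔ d d<a) (subst Odd (iterC-+ 0 d x) (odds 0 k≥1)))

    fits-sound : ∀ w K → Bool.T (fits w K) → fromℚᵘ w ℚ.≤ threeQuarters K
    fits-sound w K ok = fromℚᵘ-≤ {w} (ℚᵘ.≤-respʳ-≃ (ℚᵘ.≃-sym (threeQuarters≃ K)) (ℚᵘ.≤ᵇ⇒≤ ok))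

    first-run : RunBound X₀ (T x k₀) k₀ (fromℚᵘ (runWeight 0)) (runLength 0)
    first-run = run-bound 0 a≥1 run₀

    oneRun-sound : Bool.T oneRun → T x k₀ <ℚ bound X₀ k₀
    oneRun-sound ok = RunBound⇒< first-run (fits-sound (runWeight 0) (runLength 0) ok)

    twoRuns-sound : Bool.T twoRuns → (T x k₀ +ℚ T (iterC D₁ x) k₁) <ℚ bound X₀ (k₀ + k₁)
    twoRuns-sound ok with nextMin 0 in found
    ... | nothing = ⊥-elim ok
    ... | just d₁ with nextMin-sound 0 found
    ... | next , d₁<a with IsNext-unique next next₁
    ... | refl = RunBound⇒< (RunBound-+ first-run (run-bound D₁ d₁<a run₁))
                            (subst (ℚ._≤ threeQuarters (runLength 0 + runLength D₁)) (fromℚᵘ-+ (runWeight 0) (runWeight D₁))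
                                   (fits-sound (runWeight 0 ℚᵘ.+ runWeight D₁) (runLength 0 + runLength D₁) ok))

    threeRuns-sound : Bool.T threeRuns →
                      (T x k₀ +ℚ T (iterC D₁ x) k₁ +ℚ T (iterC D₂ x) k₂) <ℚ bound X₀ (k₀ + k₁ + k₂)
    threeRuns-sound ok with nextMin 0 in found₁
    ... | nothing = ⊥-elim ok
    ... | just d₁ with nextMin d₁ in found₂
    ... | nothing = ⊥-elim ok
    ... | just d₂ with nextMin-sound 0 found₁ | nextMin-sound d₁ found₂
    ... | next₁′ , d₁<a | next₂′ , d₂<a with IsNext-unique next₁′ next₁
    ... | refl with IsNext-unique next₂′ next₂
    ... | refl = RunBound⇒< (RunBound-+ (RunBound-+ first-run (run-bound D₁ d₁<a run₁)) (run-bound D₂ d₂<a run₂))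
                            (subst (ℚ._≤ threeQuarters (runLength 0 + runLength D₁ + runLength D₂)) weights
                                   (fits-sound (runWeight 0 ℚᵘ.+ runWeight D₁ ℚᵘ.+ runWeight D₂)
                                               (runLength 0 + runLength D₁ + runLength D₂) ok))
      where
      weights : fromℚᵘ (runWeight 0 ℚᵘ.+ runWeight D₁ ℚᵘ.+ runWeight D₂)
                ≡ fromℚᵘ (runWeight 0) +ℚ fromℚᵘ (runWeight D₁) +ℚ fromℚᵘ (runWeight D₂)
      weights = trans (fromℚᵘ-+ (runWeight 0 ℚᵘ.+ runWeight D₁) (runWeight D₂))
                      (cong (_+ℚ fromℚᵘ (runWeight D₂)) (fromℚᵘ-+ (runWeight 0) (runWeight D₁)))

    someRunsFit-sound : Bool.T someRunsFit → MinimaBound X₀ x (iterC D₁ x) (iterC D₂ x) k₀ k₁ k₂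
    someRunsFit-sound ok with Equivalence.to (Bool.T-∨ {oneRun}) ok
    ... | inj₁ one = inj₁ (oneRun-sound one)
    ... | inj₂ more with Equivalence.to (Bool.T-∨ {twoRuns}) more
    ... | inj₁ two   = inj₂ (inj₁ (twoRuns-sound two))
    ... | inj₂ three = inj₂ (inj₂ (threeRuns-sound three))

  covered-sound : ∀ a f c u → 1 ≤ a → Bool.T (covered a f c) → x ≡ ⟦ f ⟧ u →
                  MinimaBound X₀ x (iterC D₁ x) (iterC D₂ x) k₀ k₁ k₂
  covered-sound a f leaf u a≥1 ok x≡ with Equivalence.to (Bool.T-∧ {AffineFor a f}) ok
  ... | valid , fit with Equivalence.to (Bool.T-∨ {Window.someRunsFit a f 0}) fit
  ... | inj₁ fit₀ = WindowSoundness.someRunsFit-sound a≥1 valid z≤n x≡ fit₀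
  ... | inj₂ fitₐ = WindowSoundness.someRunsFit-sound a≥1 valid ℕ.≤-refl x≡ fitₐ
  covered-sound a (A ·u+ R) (split c₀ c₁) u a≥1 ok x≡
    with Equivalence.to (Bool.T-∧ {covered (suc a) (2 * A ·u+ R) c₀}) ok | parity u
  ... | ok₀ , _ | even v = covered-sound (suc a) _ c₀ v (s≤s z≤n) ok₀ (trans x≡ (split-even A R v))
    where
    split-even : ∀ A R v → A * (v + v) + R ≡ 2 * A * v + R
    split-even = solve-∀
  ... | _ , ok₁ | odd v = covered-sound (suc a) _ c₁ v (s≤s z≤n) ok₁ (trans x≡ (split-odd A R v))
    where
    split-odd : ∀ A R v → A * suc (v + v) + R ≡ 2 * A * v + (A + R)
    split-odd = solve-∀

  minima-bound : MinimaBound X₀ x (iterC D₁ x) (iterC D₂ x) k₀ k₁ k₂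
  minima-bound =
    let m , x≡ = odd-shape (proj₁ (proj₂ run₀) 0 (proj₁ run₀))
    in covered-sound 1 (2 ·u+ 1) residue-tree m ℕ.≤-refl odd-residues-covered x≡

-- Local minima of a cycle

localMin⇔evenOdd : ∀ {y} → 1 ≤ y → (C y < y × C y < C (C y)) ⇔ (Even y × Odd (C y))
localMin⇔evenOdd {y} y≥1 =
  mk⇔ (λ (down , up) → Equivalence.to (C<⇔even y≥1) down , Equivalence.to (<C⇔odd (C y)) up)
      (λ (even-y , odd-Cy) → Equivalence.from (C<⇔even y≥1) even-y , Equivalence.from (<C⇔odd (C y)) odd-Cy)

LocalMinAt-suc : ∀ {n p} → iterC p n ≡ n → 1 ≤ p → ∀ t →
                 LocalMinAt n p (suc t) ≡ (C (iterC t n) < iterC t n × C (iterC t n) < C (C (iterC t n)))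
LocalMinAt-suc {n} {suc p′} per _ t =
  cong₂ _×_ (cong₂ _<_ (iterC-suc t n) predecessor)
            (cong₂ _<_ (iterC-suc t n) (trans (iterC-suc (suc t) n) (cong C (iterC-suc t n))))
  where
  predecessor : iterC (suc p′ ∸ 1 + suc t) n ≡ iterC t n
  predecessor = trans (cong (λ m → iterC m n) (exponent p′ t)) (Periodic.iterC-periodic per t 1)
    where
    exponent : ∀ p′ t → p′ + suc t ≡ t + 1 * suc p′
    exponent = solve-∀

LocalMinAt⇔EvenOddAt : ∀ {n p} → 1 ≤ n → 1 ≤ p → iterC p n ≡ n → ∀ c t → 0 < t →
                       LocalMinAt n p (t + c) ⇔ EvenOddAt (iterC c n) t
LocalMinAt⇔EvenOddAt {n} {p} n≥1 p≥1 per c (suc d) _ =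
  subst₂ _⇔_ local-min even-odd (localMin⇔evenOdd (iterC-pos d (iterC-pos c n≥1)))
  where
  y = iterC d (iterC c n)
  local-min : (C y < y × C y < C (C y)) ≡ LocalMinAt n p (suc d + c)
  local-min = trans (cong (λ z → C z < z × C z < C (C z)) (sym (iterC-+ d c n)))
                    (sym (LocalMinAt-suc per p≥1 (d + c)))
  even-odd : (Even y × Odd (C y)) ≡ EvenOddAt (iterC c n) (suc d)
  even-odd = cong (λ z → Even y × Odd z) (sym (iterC-suc d (iterC c n)))

module Increasing {s : ℕ → ℕ} (s-suc : ∀ j → s j < s (suc j)) where

  s-mono : ∀ {i j} → i < j → s i < s j
  s-mono {i} {suc j} i<1+j with ℕ.m≤n⇒m<n∨m≡n (ℕ.m<1+n⇒m≤n i<1+j)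
  ... | inj₁ i<j  = ℕ.<-trans (s-mono i<j) (s-suc j)
  ... | inj₂ refl = s-suc i

  s-mono-≤ : ∀ {i j} → i ≤ j → s i ≤ s j
  s-mono-≤ i≤j with ℕ.m≤n⇒m<n∨m≡n i≤j
  ... | inj₁ i<j  = ℕ.<⇒≤ (s-mono i<j)
  ... | inj₂ refl = ℕ.≤-refl

  s-mono⁻¹ : ∀ {i j} → s i < s j → i < j
  s-mono⁻¹ {i} {j} si<sj with ℕ.<-cmp i j
  ... | tri< i<j _ _  = i<j
  ... | tri≈ _ refl _ = contradiction si<sj (ℕ.<-irrefl refl)
  ... | tri> _ _ j<i  = contradiction si<sj (ℕ.<-asym (s-mono j<i))

  consecutive : ∀ {P : ℕ → Set} → (∀ t → P t ⇔ ∃ λ j → s j ≡ t) → ∀ j → IsNext P (s j) (s (suc j))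
  consecutive {P} P⇔ j = s-suc j , Equivalence.from (P⇔ _) (suc j , refl) , between
    where
    between : ∀ t → s j < t → t < s (suc j) → ¬ P t
    between t above below P-t with Equivalence.to (P⇔ t) P-t
    ... | l , refl = contradiction (s-mono⁻¹ below) (ℕ.≤⇒≯ (s-mono⁻¹ above))

next-minimum : ∀ {n p} {s : ℕ → ℕ} → NontrivialCycle n p → (∀ j → s j < s (suc j)) →
               (∀ t → LocalMinAt n p t ⇔ (∃ λ j → s j ≡ t)) →
               ∀ i j → i ≤ j → IsNext (EvenOddAt (iterC (s i) n)) (s j ∸ s i) (s (suc j) ∸ s i)
next-minimum {s = s} (n≥1 , p≥1 , per , _) s-suc minima i j i≤j =
  IsNext-cong (λ t above _ → LocalMinAt⇔EvenOddAt n≥1 p≥1 per (s i) t (ℕ.≤-<-trans z≤n above))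
              (IsNext-relative (s-mono-≤ i≤j) (consecutive minima j))
  where open Increasing s-suc

lemma26 : (X₀ : ℕ) → IsX0 X₀ →
          (n p : ℕ) → NontrivialCycle n p →
          (m : ℕ) → 1 ≤ m →
          (s : ℕ → ℕ) → (∀ i → s i < s (i + 1)) → (∀ i → s (i + m) ≡ s i + p) →
          (∀ t → LocalMinAt n p t ⇔ (∃ λ i → s i ≡ t)) →
          (i k₀ k₁ k₂ : ℕ) →
          IsK (iterC (s i) n) k₀ → IsK (iterC (s (i + 1)) n) k₁ → IsK (iterC (s (i + 2)) n) k₂ →
          (T (iterC (s i) n) k₀ <ℚ bound X₀ k₀)
          ⊎ ((T (iterC (s i) n) k₀ +ℚ T (iterC (s (i + 1)) n) k₁) <ℚ bound X₀ (k₀ + k₁))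
          ⊎ ((T (iterC (s i) n) k₀ +ℚ T (iterC (s (i + 1)) n) k₁ +ℚ T (iterC (s (i + 2)) n) k₂)
              <ℚ bound X₀ (k₀ + k₁ + k₂))
lemma26 X₀ isX0 n p cycle _ _ s s-inc _ minima i k₀ k₁ k₂ run₀ run₁ run₂
  rewrite ℕ.+-comm i 1 | ℕ.+-comm i 2 =
  subst₂ (λ y z → MinimaBound X₀ x y z k₀ k₁ k₂) shift₁ shift₂
    (MinimaBounds.minima-bound X₀≥1 above next₁ next₂ run₀
      (subst (λ y → IsK y k₁) (sym shift₁) run₁) (subst (λ y → IsK y k₂) (sym shift₂) run₂))
  where
  x = iterC (s i) n
  X₀≥1 : 1 ≤ X₀
  X₀≥1 = ℕ.≤-trans (s≤s z≤n) (ℕ.<⇒≤ (proj₁ isX0))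
  above : ∀ t → X₀ < iterC t x
  above t = subst (X₀ <_) (iterC-+ t (s i) n) (nontrivial-cycle-above isX0 cycle (t + s i))
  s-suc : ∀ j → s j < s (suc j)
  s-suc j = subst (λ l → s j < s l) (ℕ.+-comm j 1) (s-inc j)
  next : ∀ j → i ≤ j → IsNext (EvenOddAt x) (s j ∸ s i) (s (suc j) ∸ s i)
  next = next-minimum {s = s} cycle s-suc minima i
  next₁ : IsNext (EvenOddAt x) 0 (s (suc i) ∸ s i)
  next₁ = subst (λ d → IsNext (EvenOddAt x) d (s (suc i) ∸ s i)) (ℕ.n∸n≡0 (s i)) (next i ℕ.≤-refl)
  next₂ : IsNext (EvenOddAt x) (s (suc i) ∸ s i) (s (suc (suc i)) ∸ s i)
  next₂ = next (suc i) (ℕ.n≤1+n i)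
  shift₁ : iterC (s (suc i) ∸ s i) x ≡ iterC (s (suc i)) n
  shift₁ = iterC-∸ n (Increasing.s-mono-≤ s-suc (ℕ.n≤1+n i))
  shift₂ : iterC (s (suc (suc i)) ∸ s i) x ≡ iterC (s (suc (suc i))) n
  shift₂ = iterC-∸ n (Increasing.s-mono-≤ s-suc (ℕ.m≤n+m i 2))
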